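{- Let $n\ge 2$. Then \[ \sum_{\sigma \in D_n}(-1)^{\ell_D(\sigma)}x^{\mathrm{oinv}(\sigma)}y^{\mathrm{onsp}(\sigma)}=\sum_{\sigma \in C(D_n)}(-1)^{\ell_D(\sigma)}x^{\mathrm{oinv}(\sigma)}y^{\mathrm{onsp}(\sigma)}. \]
   Context: $D_n$ is the group of signed permutations $\sigma$ of $[n]$ (bijections of $\{\pm1,\dots,\pm n\}$ with $\sigma(-i)=-\sigma(i)$) whose window $[\sigma(1),\dots,\sigma(n)]$ has an even number of negative entries, with Coxeter length $\ell_D(\sigma)=\mathrm{inv}(\sigma)+\mathrm{nsp}(\sigma)$, where $\mathrm{inv}(\sigma)=|\{(i,j):i<j,\ \sigma(i)>\sigma(j)\}|$, $\mathrm{nsp}(\sigma)=|\{(i,j):i<j,\ \sigma(i)+\sigma(j)<0\}|$. $\mathrm{oinv}(\sigma)$ counts pairs $i<j$ with $\sigma(i)>\sigma(j)$ and $j-i$ odd; $\mathrm{onsp}(\sigma)$ counts pairs $i<j$ with $\sigma(i)+\sigma(j)<0$ and $j-i$ odd. An element $\sigma\in D_n$ is chessboard if $\sigma(i)\equiv i\pmod 2$ for all $i\in[n]$, or $\sigma(i)\equiv i+1\pmod 2$ for all $i\in[n]$; $C(D_n)$ is the set of chessboard elements of $D_n$. -}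

module Defs where

open import Data.Bool using (Bool; true; false; _∧_; _∨_; if_then_else_; not)
open import Data.Nat as ℕ using (ℕ; zero; suc; _%_; _≡ᵇ_)
open import Data.Integer as ℤ using (ℤ; +_; -_; ∣_∣)
open import Data.List using (List; []; _∷_; map; _++_; length; concatMap; upTo; zip; foldr)
open import Data.Product using (_×_; _,_)
open import Relation.Nullary.Decidable using (does)

-- A signed permutation σ of [n] is represented by its window
-- [σ(1), …, σ(n)] as a list of integers.
Window : Set
Window = List ℤ

range : ℕ → List ℤ
range n = map (λ k → ℤ._-_ (+ k) (+ n)) (upTo (suc (ℕ._+_ n n)))

words : ℕ → ℕ → List Window
words n zero = [] ∷ []
words n (suc k) = concatMap (λ w → map (λ x → x ∷ w) (range n)) (words n k)

filterB : {A : Set} → (A → Bool) → List A → List A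
filterB p [] = []
filterB p (x ∷ xs) = if p x then x ∷ filterB p xs else filterB p xs

allB : {A : Set} → (A → Bool) → List A → Bool
allB p [] = true
allB p (x ∷ xs) = p x ∧ allB p xs

countB : {A : Set} → (A → Bool) → List A → ℕ
countB p xs = length (filterB (λ x → p x) xs)

isEvenB : ℕ → Bool
isEvenB m = m % 2 ≡ᵇ 0

-- w is the window of a signed permutation of [n]: every i ∈ [n] occurs
-- exactly once as |σ(j)| (with n entries this forces all |σ(j)| ∈ [n]).
isSignedPerm : ℕ → Window → Bool
isSignedPerm n w =
  (length w ≡ᵇ n) ∧ allB (λ i → countB (λ x → ∣ x ∣ ≡ᵇ suc i) w ≡ᵇ 1) (upTo n)

negB : ℤ → Bool
negB x = does (x ℤ.<? + 0)

isDn : ℕ → Window → Bool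
isDn n w = isSignedPerm n w ∧ isEvenB (countB negB w)

Dn : ℕ → List Window
Dn n = filterB (λ w → isDn n w) (words n n)

-- all pairs (σ(i), σ(j), j - i) with i < j
pairs : Window → List (ℤ × ℤ × ℕ)
pairs [] = []
pairs (h ∷ t) = map (λ { (k , b) → (h , b , suc k) }) (zip (upTo (length t)) t) ++ pairs t

gtB : ℤ → ℤ → Bool
gtB a b = does (b ℤ.<? a)

inv : Window → ℕ
inv w = countB (λ { (a , b , d) → gtB a b }) (pairs w)

nsp : Window → ℕ
nsp w = countB (λ { (a , b , d) → negB (a ℤ.+ b) }) (pairs w)

oinv : Window → ℕ
oinv w = countB (λ { (a , b , d) → gtB a b ∧ not (isEvenB d) }) (pairs w)

onsp : Window → ℕ
onsp w = countB (λ { (a , b , d) → negB (a ℤ.+ b) ∧ not (isEvenB d) }) (pairs w)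

ℓD : Window → ℕ
ℓD w = ℕ._+_ (inv w) (nsp w)

signPow : ℕ → ℤ
signPow m = if isEvenB m then + 1 else ℤ.-_ (+ 1)

sameParity : ℤ → ℕ → Bool
sameParity x i = (∣ x ∣ % 2) ≡ᵇ (i % 2)

indexed : Window → List (ℕ × ℤ)
indexed w = zip (map suc (upTo (length w))) w

isChessboard : Window → Bool
isChessboard w =
  allB (λ { (i , x) → sameParity x i }) (indexed w)
  ∨ allB (λ { (i , x) → sameParity x (suc i) }) (indexed w)

CDn : ℕ → List Window
CDn n = filterB (λ w → isChessboard w) (Dn n)

-- coefficient of x^a y^b in Σ_{σ ∈ S} (-1)^{ℓ_D(σ)} x^{oinv σ} y^{onsp σ}
coeff : List Window → ℕ → ℕ → ℤ
coeff S a b =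
  foldr ℤ._+_ (+ 0)
    (map signPow'
      (filterB (λ w → ((oinv w ≡ᵇ a) ∧ (onsp w ≡ᵇ b))) S))
  where
    signPow' : Window → ℤ
    signPow' w = signPow (ℓD w)

module Submission where

-- Split D_n into chessboard and non-chessboard elements;
-- it suffices that the signed contribution of the non-chessboard ones to
-- each coefficient x^a y^b vanishes.  For a window w and a value k ∈ [n]
-- let the label of k be "parity of k = parity of the position of ±k".
-- w is chessboard iff all n labels agree.  Otherwise pick the first u with
-- differing labels at u+1, u+2 and exchange the absolute values u+1 and
-- u+2 (keeping signs).  Differing labels mean ±(u+1) and ±(u+2) sit at
-- positions of equal parity, so the only pair whose comparisons change is
-- at even distance: oinv and onsp are kept, while inv + nsp changes by
-- exactly one, flipping (-1)^ℓ_D.  All labels are kept, so this is a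
-- fixed-point-free sign-reversing involution on the non-chessboard part,
-- and such a sum is zero.

open import Defs

open import Data.Bool using (Bool; true; false; _∧_; _∨_; not; _xor_; if_then_else_)
open import Data.Bool.Properties
  using ( not-involutive; not-distribˡ-xor; not-distribʳ-xor; xor-same; xor-comm; xor-assoc
        ; ∧-zeroʳ; ∧-distribˡ-xor; ∨-zeroʳ; xor-annihilates-not; T-≡; ⇔→≡)
open import Data.Bool.Solver using (module xor-∧-Solver)
open import Data.Nat as ℕ using (ℕ; zero; suc; _+_; _∸_; _≤_; _<_; z≤n; s≤s; _≡ᵇ_; _<ᵇ_; _%_)
open import Data.Nat.Properties
  using ( ≡ᵇ⇒≡; ≡⇒≡ᵇ; ≤-refl; ≤-reflexive; ≤-trans; n≤1+n; <-irrefl; 1+n≢n; suc-injective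
        ; +-suc; +-comm; +-mono-≤; +-monoˡ-≤; m≤n+m; m≤m+n; m∸n≤m; m+n∸n≡m; m∸[m∸n]≡n
        ; +-commutativeSemigroup)
open import Data.Integer as ℤ using (ℤ; -[1+_]; ∣_∣)
open import Data.Integer.Properties using ([1+m]⊖[1+n]≡m⊖n; m-n≡m⊖n; ⊖-≥; ⊖-<; +-injective)
import Data.Integer.Properties as ℤP
open import Data.List
  using (List; []; _∷_; map; _++_; length; zip; applyUpTo; upTo; findᵇ; filterᵇ; foldr)
open import Data.List.Properties
  using (map-applyUpTo; map-++; length-++; map-∘; map-cong; map-id; length-map; ∷-injectiveˡ; ∷-injectiveʳ)
open import Data.List.Membership.Propositional using (_∈_; _∉_)
open import Data.List.Membership.Propositional.Properties
  using (∈-++⁻; ∈-++⁺ˡ; ∈-++⁺ʳ; ∈-upTo⁺; ∈-upTo⁻; ∈-map⁺; ∈-map⁻; ∈-concat⁺′; ∈-∃++)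
open import Data.List.Relation.Unary.Any using (here; there)
open import Data.List.Relation.Unary.All as All using (All; []; _∷_)
import Data.List.Relation.Unary.All.Properties as All
open import Data.List.Relation.Unary.AllPairs as AllPairs using (AllPairs; []; _∷_)
import Data.List.Relation.Unary.AllPairs.Properties as AllPairs
open import Data.List.Relation.Unary.Unique.Propositional using (Unique)
import Data.List.Relation.Unary.Unique.Propositional.Properties as Unique
open import Data.List.Relation.Binary.Disjoint.Propositional using (Disjoint)
open import Data.Maybe using (Maybe; just; nothing)
open import Data.Product using (Σ; _×_; _,_; proj₁; proj₂)
open import Data.Sum using (_⊎_; inj₁; inj₂)
open import Data.Empty using (⊥-elim)
open import Function using (_∘_; id)
open import Function.Bundles using (Equivalence; mk⇔)
open import Algebra.Bundles using (AbelianGroup)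
open import Algebra.Properties.CommutativeSemigroup +-commutativeSemigroup
  using () renaming (interchange to +-interchange)
open import Algebra.Properties.CommutativeSemigroup ℤP.+-commutativeSemigroup using (x∙yz≈y∙xz)
open import Algebra.Properties.Group (AbelianGroup.group ℤP.+-0-abelianGroup) using (∙-cancelʳ)
open import Relation.Nullary.Decidable using (T?)
open import Relation.Binary.PropositionalEquality

open xor-∧-Solver using (solve; _:+_; _:*_; _:=_)

-- odd m decides whether m is odd; unlike isEvenB it is structurally recursive.
odd : ℕ → Bool
odd zero = false
odd (suc m) = not (odd m)

isEvenB≡not-odd : ∀ m → isEvenB m ≡ not (odd m)
isEvenB≡not-odd zero = refl
isEvenB≡not-odd (suc zero) = refl
isEvenB≡not-odd (suc (suc m)) = trans (isEvenB≡not-odd m) (sym (not-involutive (not (odd m))))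

odd-+ : ∀ m n → odd (m + n) ≡ odd m xor odd n
odd-+ zero n = refl
odd-+ (suc m) n = trans (cong not (odd-+ m n)) (not-distribˡ-xor (odd m) (odd n))

odd-xor-odd-suc : ∀ s → odd s xor odd (suc s) ≡ true
odd-xor-odd-suc s = trans (sym (not-distribʳ-xor (odd s) (odd s))) (cong not (xor-same (odd s)))

sameParity≡ : ∀ x i → sameParity x i ≡ not (odd ∣ x ∣ xor odd i)
sameParity≡ x i = trans (cong₂ _≡ᵇ_ (mod2 ∣ x ∣) (mod2 i)) (bit-≡ᵇ (odd ∣ x ∣) (odd i))
  where
  bit : Bool → ℕ
  bit true = 1
  bit false = 0

  mod2 : ∀ m → m % 2 ≡ bit (odd m)
  mod2 zero = refl
  mod2 (suc zero) = refl
  mod2 (suc (suc m)) = trans (mod2 m) (cong bit (sym (not-involutive (odd m))))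

  bit-≡ᵇ : ∀ p q → (bit p ≡ᵇ bit q) ≡ not (p xor q)
  bit-≡ᵇ true true = refl
  bit-≡ᵇ true false = refl
  bit-≡ᵇ false true = refl
  bit-≡ᵇ false false = refl

signPow-flip : ∀ m m' → isEvenB m' ≡ not (isEvenB m) → signPow m' ≡ ℤ.- signPow m
signPow-flip m m' e rewrite e with isEvenB m
... | true = refl
... | false = refl

xor-true : ∀ x → x xor true ≡ not x
xor-true x = xor-comm x true

≡⇒xor-false : ∀ {p q} → p ≡ q → p xor q ≡ false
≡⇒xor-false {p} refl = xor-same p

xor-interchange : ∀ a b c d → (a xor b) xor (c xor d) ≡ (a xor c) xor (b xor d)
xor-interchange = solve 4 (λ a b c d → (a :+ b) :+ (c :+ d) := (a :+ c) :+ (b :+ d)) refl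

-- (a + x)(a′ + y) = ay + a′x + xy in the Boolean ring when a a′ = 0; this
-- counts pairs in a list extended by one element
xor-product-rule : ∀ a a′ x y → a ∧ a′ ≡ false → ((a ∧ y) xor (a′ ∧ x)) xor (x ∧ y) ≡ (a xor x) ∧ (a′ xor y)
xor-product-rule a a′ x y e = trans (cong (_xor (((a ∧ y) xor (a′ ∧ x)) xor (x ∧ y))) (sym e)) (sym (expand a a′ x y))
  where
  expand : ∀ a a′ x y → (a xor x) ∧ (a′ xor y) ≡ (a ∧ a′) xor (((a ∧ y) xor (a′ ∧ x)) xor (x ∧ y))
  expand = solve 4 (λ a a′ x y → (a :+ x) :* (a′ :+ y) := (a :* a′) :+ (((a :* y) :+ (a′ :* x)) :+ (x :* y))) refl

≡ᵇ-true : ∀ {m n} → (m ≡ᵇ n) ≡ true → m ≡ n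
≡ᵇ-true {m} {n} e = ≡ᵇ⇒≡ m n (Equivalence.from T-≡ e)

≡ᵇ-refl : ∀ m → (m ≡ᵇ m) ≡ true
≡ᵇ-refl m = Equivalence.to T-≡ (≡⇒≡ᵇ m m refl)

≢⇒≡ᵇ-false : ∀ {m n} → m ≢ n → (m ≡ᵇ n) ≡ false
≢⇒≡ᵇ-false {m} {n} m≢n with m ≡ᵇ n in e
... | true = ⊥-elim (m≢n (≡ᵇ-true e))
... | false = refl

≡ᵇ-exclusive : ∀ p s → (p ≡ᵇ s) ∧ (p ≡ᵇ suc s) ≡ false
≡ᵇ-exclusive zero zero = refl
≡ᵇ-exclusive zero (suc s) = refl
≡ᵇ-exclusive (suc p) zero = refl
≡ᵇ-exclusive (suc p) (suc s) = ≡ᵇ-exclusive p s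

-- The parity of
-- a count is the xor-sum of the predicate, which is additive in the
-- predicate; this is how parities of inv, nsp and ℓ_D are computed.
module _ {A : Set} where

  countB-∷ : ∀ (p : A → Bool) x xs → countB p (x ∷ xs) ≡ (if p x then 1 else 0) + countB p xs
  countB-∷ p x xs with p x
  ... | true = refl
  ... | false = refl

  countB-cong : ∀ (p q : A → Bool) xs → (∀ {x} → x ∈ xs → p x ≡ q x) → countB p xs ≡ countB q xs
  countB-cong p q [] h = refl
  countB-cong p q (x ∷ xs) h rewrite countB-∷ p x xs | countB-∷ q x xs | h (here refl) =
    cong (_ +_) (countB-cong p q xs (λ m → h (there m)))

  countB-≤-∷ : ∀ (p : A → Bool) x xs → countB p xs ≤ countB p (x ∷ xs)
  countB-≤-∷ p x xs rewrite countB-∷ p x xs = m≤n+m (countB p xs) (if p x then 1 else 0)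

  countB-positive : ∀ (p : A → Bool) {x} xs → x ∈ xs → p x ≡ true → 1 ≤ countB p xs
  countB-positive p (y ∷ ys) (here refl) px rewrite countB-∷ p y ys | px = s≤s z≤n
  countB-positive p (y ∷ ys) (there m) px = ≤-trans (countB-positive p ys m px) (countB-≤-∷ p y ys)

  countB-witness : ∀ (p : A → Bool) xs → 1 ≤ countB p xs → Σ A λ x → x ∈ xs × p x ≡ true
  countB-witness p (y ∷ ys) pos with p y in py
  ... | true = y , here refl , py
  ... | false = let (x , m , px) = countB-witness p ys pos in x , there m , px

  ∈-filterB⁻ : ∀ (p : A → Bool) {x} xs → x ∈ filterB p xs → x ∈ xs × p x ≡ true
  ∈-filterB⁻ p (y ∷ ys) m with p y in e
  ∈-filterB⁻ p (y ∷ ys) (here refl) | true = here refl , e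
  ∈-filterB⁻ p (y ∷ ys) (there m) | true = let (m' , px) = ∈-filterB⁻ p ys m in there m' , px
  ... | false = let (m' , px) = ∈-filterB⁻ p ys m in there m' , px

  ∈-filterB⁺ : ∀ (p : A → Bool) {x} xs → x ∈ xs → p x ≡ true → x ∈ filterB p xs
  ∈-filterB⁺ p (y ∷ ys) (here refl) px rewrite px = here refl
  ∈-filterB⁺ p (y ∷ ys) (there m) px with p y
  ... | true = there (∈-filterB⁺ p ys m px)
  ... | false = ∈-filterB⁺ p ys m px

  allB-true⁻ : ∀ (p : A → Bool) xs → allB p xs ≡ true → ∀ {x} → x ∈ xs → p x ≡ true
  allB-true⁻ p (y ∷ ys) e m with p y in py
  allB-true⁻ p (y ∷ ys) e (here refl) | true = py
  allB-true⁻ p (y ∷ ys) e (there m) | true = allB-true⁻ p ys e m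

  allB-true⁺ : ∀ (p : A → Bool) xs → (∀ {x} → x ∈ xs → p x ≡ true) → allB p xs ≡ true
  allB-true⁺ p [] h = refl
  allB-true⁺ p (y ∷ ys) h rewrite h (here refl) = allB-true⁺ p ys (λ m → h (there m))

  allB-cong : ∀ (p q : A → Bool) xs → (∀ x → p x ≡ q x) → allB p xs ≡ allB q xs
  allB-cong p q [] h = refl
  allB-cong p q (x ∷ xs) h = cong₂ _∧_ (h x) (allB-cong p q xs h)

  xorSum : (A → Bool) → List A → Bool
  xorSum p [] = false
  xorSum p (x ∷ xs) = p x xor xorSum p xs

  odd-countB-∷ : ∀ (p : A → Bool) x xs → odd (countB p (x ∷ xs)) ≡ p x xor odd (countB p xs)
  odd-countB-∷ p x xs with p x
  ... | true = refl
  ... | false = refl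

  odd-countB : ∀ (p : A → Bool) xs → odd (countB p xs) ≡ xorSum p xs
  odd-countB p [] = refl
  odd-countB p (x ∷ xs) = trans (odd-countB-∷ p x xs) (cong (p x xor_) (odd-countB p xs))

  xorSum-++ : ∀ (p : A → Bool) xs ys → xorSum p (xs ++ ys) ≡ xorSum p xs xor xorSum p ys
  xorSum-++ p [] ys = refl
  xorSum-++ p (x ∷ xs) ys = trans (cong (p x xor_) (xorSum-++ p xs ys)) (sym (xor-assoc (p x) _ _))

  xorSum-cong : ∀ (p q : A → Bool) xs → (∀ x → p x ≡ q x) → xorSum p xs ≡ xorSum q xs
  xorSum-cong p q [] h = refl
  xorSum-cong p q (x ∷ xs) h = cong₂ _xor_ (h x) (xorSum-cong p q xs h)

  xorSum-xor : ∀ (p q : A → Bool) xs → xorSum (λ x → p x xor q x) xs ≡ xorSum p xs xor xorSum q xs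
  xorSum-xor p q [] = refl
  xorSum-xor p q (x ∷ xs) rewrite xorSum-xor p q xs = xor-interchange (p x) (q x) (xorSum p xs) (xorSum q xs)

  xorSum-∧ˡ : ∀ c (p : A → Bool) xs → xorSum (λ x → c ∧ p x) xs ≡ c ∧ xorSum p xs
  xorSum-∧ˡ c p [] = sym (∧-zeroʳ c)
  xorSum-∧ˡ c p (x ∷ xs) = trans (cong (c ∧ p x xor_) (xorSum-∧ˡ c p xs)) (sym (∧-distribˡ-xor c (p x) _))

xorSum-map : ∀ {A B : Set} (p : B → Bool) (f : A → B) xs → xorSum p (map f xs) ≡ xorSum (λ x → p (f x)) xs
xorSum-map p f [] = refl
xorSum-map p f (x ∷ xs) = cong (p (f x) xor_) (xorSum-map p f xs)

countB-map : ∀ {A B : Set} (p : B → Bool) (f : A → B) xs → countB p (map f xs) ≡ countB (λ x → p (f x)) xs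
countB-map p f [] = refl
countB-map p f (x ∷ xs) with p (f x)
... | true = cong suc (countB-map p f xs)
... | false = countB-map p f xs

swap : ℕ → ℕ → ℕ
swap zero zero = 1
swap zero (suc zero) = 0
swap zero (suc (suc q)) = suc (suc q)
swap (suc s) zero = 0
swap (suc s) (suc q) = suc (swap s q)

swap-involutive : ∀ s p → swap s (swap s p) ≡ p
swap-involutive zero zero = refl
swap-involutive zero (suc zero) = refl
swap-involutive zero (suc (suc p)) = refl
swap-involutive (suc s) zero = refl
swap-involutive (suc s) (suc p) = cong suc (swap-involutive s p)

-- swap s is self-inverse, so it can be moved across an equality test
swap-≡ᵇ : ∀ s a k → (swap s a ≡ᵇ k) ≡ (a ≡ᵇ swap s k)
swap-≡ᵇ zero zero zero = refl
swap-≡ᵇ zero zero (suc zero) = refl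
swap-≡ᵇ zero zero (suc (suc k)) = refl
swap-≡ᵇ zero (suc zero) zero = refl
swap-≡ᵇ zero (suc zero) (suc zero) = refl
swap-≡ᵇ zero (suc zero) (suc (suc k)) = refl
swap-≡ᵇ zero (suc (suc a)) zero = refl
swap-≡ᵇ zero (suc (suc a)) (suc zero) = refl
swap-≡ᵇ zero (suc (suc a)) (suc (suc k)) = refl
swap-≡ᵇ (suc s) zero zero = refl
swap-≡ᵇ (suc s) zero (suc k) = refl
swap-≡ᵇ (suc s) (suc a) zero = refl
swap-≡ᵇ (suc s) (suc a) (suc k) = swap-≡ᵇ s a k

swap-< : ∀ u i n → i < n → suc u < n → swap u i < n
swap-< zero zero n i<n u<n = u<n
swap-< zero (suc zero) n i<n u<n = ≤-trans (s≤s z≤n) i<n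
swap-< zero (suc (suc i)) n i<n u<n = i<n
swap-< (suc u) zero n i<n u<n = i<n
swap-< (suc u) (suc i) (suc n) (s≤s i<n) (s≤s u<n) = s≤s (swap-< u i n i<n u<n)

swap-invariant : ∀ {A : Set} (f : ℕ → A) s → f s ≡ f (suc s) → ∀ k → f (swap s k) ≡ f k
swap-invariant f zero e zero = sym e
swap-invariant f zero e (suc zero) = e
swap-invariant f zero e (suc (suc k)) = refl
swap-invariant f (suc s) e zero = refl
swap-invariant f (suc s) e (suc k) = swap-invariant (λ m → f (suc m)) s e k

swap-s : ∀ s → swap s s ≡ suc s
swap-s zero = refl
swap-s (suc s) = cong suc (swap-s s)

crosses : ℕ → ℕ → ℕ → Bool
crosses s p q = ((p ≡ᵇ s) ∧ (q ≡ᵇ suc s)) xor ((p ≡ᵇ suc s) ∧ (q ≡ᵇ s))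

crosses-sym : ∀ s p q → crosses s p q ≡ crosses s q p
crosses-sym s p q = solve 4 (λ a b c d → (a :* b) :+ (c :* d) := (d :* c) :+ (b :* a)) refl
  (p ≡ᵇ s) (q ≡ᵇ suc s) (p ≡ᵇ suc s) (q ≡ᵇ s)

crosses-true : ∀ s p q → crosses s p q ≡ true → (p ≡ s × q ≡ suc s) ⊎ (p ≡ suc s × q ≡ s)
crosses-true s p q e with p ≡ᵇ s in e₁ | q ≡ᵇ suc s in e₂ | p ≡ᵇ suc s in e₃ | q ≡ᵇ s in e₄
... | true | true | _ | _ = inj₁ (≡ᵇ-true e₁ , ≡ᵇ-true e₂)
... | _ | _ | true | true = inj₂ (≡ᵇ-true e₃ , ≡ᵇ-true e₄)
crosses-true s p q () | false | _ | false | _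
crosses-true s p q () | false | _ | true | false
crosses-true s p q () | true | false | false | _
crosses-true s p q () | true | false | true | false

swap-<ᵇ : ∀ s p q → (swap s q <ᵇ swap s p) ≡ crosses s p q xor (q <ᵇ p)
swap-<ᵇ zero zero zero = refl
swap-<ᵇ zero zero (suc zero) = refl
swap-<ᵇ zero zero (suc (suc q)) = refl
swap-<ᵇ zero (suc zero) zero = refl
swap-<ᵇ zero (suc zero) (suc zero) = refl
swap-<ᵇ zero (suc zero) (suc (suc q)) = refl
swap-<ᵇ zero (suc (suc p)) zero = refl
swap-<ᵇ zero (suc (suc p)) (suc zero) = refl
swap-<ᵇ zero (suc (suc p)) (suc (suc q)) = refl
swap-<ᵇ (suc s) zero q = refl
swap-<ᵇ (suc s) (suc p) zero rewrite ∧-zeroʳ (p ≡ᵇ s) | ∧-zeroʳ (p ≡ᵇ suc s) = refl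
swap-<ᵇ (suc s) (suc p) (suc q) = swap-<ᵇ s p q

-- swapAbs u exchanges the absolute values u+1 and u+2 and keeps signs; on
-- windows of signed permutations it is left multiplication by the simple
-- transposition of u+1 and u+2.
swapAbs : ℕ → ℤ → ℤ
swapAbs u (ℤ.+ m) = ℤ.+ swap (suc u) m
swapAbs u -[1+ m ] = -[1+ swap u m ]

∣swapAbs∣ : ∀ u x → ∣ swapAbs u x ∣ ≡ swap (suc u) ∣ x ∣
∣swapAbs∣ u (ℤ.+ m) = refl
∣swapAbs∣ u -[1+ m ] = refl

swapAbs-involutive : ∀ u x → swapAbs u (swapAbs u x) ≡ x
swapAbs-involutive u (ℤ.+ m) = cong ℤ.+_ (swap-involutive (suc u) m)
swapAbs-involutive u -[1+ m ] = cong -[1+_] (swap-involutive u m)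

negB-swapAbs : ∀ u x → negB (swapAbs u x) ≡ negB x
negB-swapAbs u (ℤ.+ m) = refl
negB-swapAbs u -[1+ m ] = refl

negB-⊖ : ∀ m n → negB (m ℤ.⊖ n) ≡ (m <ᵇ n)
negB-⊖ zero zero = refl
negB-⊖ zero (suc n) = refl
negB-⊖ (suc m) zero = refl
negB-⊖ (suc m) (suc n) = trans (cong negB ([1+m]⊖[1+n]≡m⊖n m n)) (negB-⊖ m n)

gtB-swapAbs : ∀ u a b → crosses (suc u) ∣ a ∣ ∣ b ∣ ≡ false →
              gtB (swapAbs u a) (swapAbs u b) ≡ gtB a b
gtB-swapAbs u (ℤ.+ m) (ℤ.+ k) e = trans (swap-<ᵇ (suc u) m k) (cong (_xor (k <ᵇ m)) e)
gtB-swapAbs u (ℤ.+ m) -[1+ k ] e = refl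
gtB-swapAbs u -[1+ m ] (ℤ.+ k) e = refl
gtB-swapAbs u -[1+ m ] -[1+ k ] e =
  trans (swap-<ᵇ u k m) (cong (_xor (m <ᵇ k)) (trans (crosses-sym u k m) e))

negSumB-swapAbs : ∀ u a b → crosses (suc u) ∣ a ∣ ∣ b ∣ ≡ false →
                  negB (swapAbs u a ℤ.+ swapAbs u b) ≡ negB (a ℤ.+ b)
negSumB-swapAbs u (ℤ.+ m) (ℤ.+ k) e = refl
negSumB-swapAbs u (ℤ.+ m) -[1+ k ] e = begin
  negB (swap (suc u) m ℤ.⊖ suc (swap u k)) ≡⟨ negB-⊖ (swap (suc u) m) (suc (swap u k)) ⟩
  (swap (suc u) m <ᵇ swap (suc u) (suc k)) ≡⟨ swap-<ᵇ (suc u) (suc k) m ⟩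
  crosses (suc u) (suc k) m xor (m <ᵇ suc k) ≡⟨ cong (_xor (m <ᵇ suc k)) (trans (crosses-sym (suc u) (suc k) m) e) ⟩
  (m <ᵇ suc k) ≡⟨ negB-⊖ m (suc k) ⟨
  negB (m ℤ.⊖ suc k) ∎
  where open ≡-Reasoning
negSumB-swapAbs u -[1+ m ] (ℤ.+ k) e = begin
  negB (swap (suc u) k ℤ.⊖ suc (swap u m)) ≡⟨ negB-⊖ (swap (suc u) k) (suc (swap u m)) ⟩
  (swap (suc u) k <ᵇ swap (suc u) (suc m)) ≡⟨ swap-<ᵇ (suc u) (suc m) k ⟩
  crosses (suc u) (suc m) k xor (k <ᵇ suc m) ≡⟨ cong (_xor (k <ᵇ suc m)) e ⟩
  (k <ᵇ suc m) ≡⟨ negB-⊖ k (suc m) ⟨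
  negB (k ℤ.⊖ suc m) ∎
  where open ≡-Reasoning
negSumB-swapAbs u -[1+ m ] -[1+ k ] e = refl

inversionTest : ℤ → ℤ → Bool
inversionTest a b = gtB a b xor negB (a ℤ.+ b)

inversionTest-swapAbs : ∀ u a b →
  inversionTest (swapAbs u a) (swapAbs u b) ≡ crosses (suc u) ∣ a ∣ ∣ b ∣ xor inversionTest a b
inversionTest-swapAbs u (ℤ.+ m) (ℤ.+ k) =
  trans (cong (_xor false) (swap-<ᵇ (suc u) m k)) (xor-assoc (crosses (suc u) m k) (k <ᵇ m) false)
inversionTest-swapAbs u (ℤ.+ m) -[1+ k ] = begin
  not (negB (swap (suc u) m ℤ.⊖ suc (swap u k)))  ≡⟨ cong not (negB-⊖ (swap (suc u) m) (suc (swap u k))) ⟩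
  not (swap (suc u) m <ᵇ swap (suc u) (suc k))    ≡⟨ cong not (swap-<ᵇ (suc u) (suc k) m) ⟩
  not (c′ xor (m <ᵇ suc k))
    ≡⟨ cong (λ c → not (c xor (m <ᵇ suc k))) (crosses-sym (suc u) (suc k) m) ⟩
  not (c xor (m <ᵇ suc k))                        ≡⟨ not-distribʳ-xor c (m <ᵇ suc k) ⟩
  c xor not (m <ᵇ suc k)                          ≡⟨ cong (λ n → c xor not n) (negB-⊖ m (suc k)) ⟨
  c xor not (negB (m ℤ.⊖ suc k))                  ∎
  where
  open ≡-Reasoning
  c c′ : Bool
  c = crosses (suc u) m (suc k)
  c′ = crosses (suc u) (suc k) m
inversionTest-swapAbs u -[1+ m ] (ℤ.+ k) = begin
  negB (swap (suc u) k ℤ.⊖ suc (swap u m))        ≡⟨ negB-⊖ (swap (suc u) k) (suc (swap u m)) ⟩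
  (swap (suc u) k <ᵇ swap (suc u) (suc m))        ≡⟨ swap-<ᵇ (suc u) (suc m) k ⟩
  crosses (suc u) (suc m) k xor (k <ᵇ suc m)      ≡⟨ cong (crosses (suc u) (suc m) k xor_) (negB-⊖ k (suc m)) ⟨
  crosses (suc u) (suc m) k xor negB (k ℤ.⊖ suc m) ∎
  where open ≡-Reasoning
inversionTest-swapAbs u -[1+ m ] -[1+ k ] =
  trans (cong (_xor true) (trans (swap-<ᵇ u k m) (cong (_xor (m <ᵇ k)) (crosses-sym u k m))))
        (xor-assoc (crosses u m k) (m <ᵇ k) true)

-- These are the lists of Defs with
-- the zip against upTo unfolded.
positionsFrom : ℕ → Window → List (ℕ × ℤ)
positionsFrom k [] = []
positionsFrom k (x ∷ t) = (k , x) ∷ positionsFrom (suc k) t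

pairsFrom : ℤ → ℕ → Window → List (ℤ × ℤ × ℕ)
pairsFrom h k [] = []
pairsFrom h k (x ∷ t) = (h , x , k) ∷ pairsFrom h (suc k) t

allPairs : Window → List (ℤ × ℤ × ℕ)
allPairs [] = []
allPairs (h ∷ t) = pairsFrom h 1 t ++ allPairs t

zip-applyUpTo : ∀ (f : ℕ → ℕ) k t → (∀ i → f i ≡ i + k) →
                zip (applyUpTo f (length t)) t ≡ positionsFrom k t
zip-applyUpTo f k [] e = refl
zip-applyUpTo f k (x ∷ t) e = cong₂ _∷_ (cong (_, x) (e 0))
  (zip-applyUpTo (f ∘ suc) (suc k) t (λ i → trans (e (suc i)) (sym (+-suc i k))))

map-zip-applyUpTo : ∀ (F : ℕ × ℤ → ℤ × ℤ × ℕ) h (f : ℕ → ℕ) k t →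
  (∀ i b → F (f i , b) ≡ (h , b , i + k)) → map F (zip (applyUpTo f (length t)) t) ≡ pairsFrom h k t
map-zip-applyUpTo F h f k [] e = refl
map-zip-applyUpTo F h f k (x ∷ t) e = cong₂ _∷_ (e 0 x)
  (map-zip-applyUpTo F h (f ∘ suc) (suc k) t (λ i b → trans (e (suc i) b) (cong (λ d → h , b , d) (sym (+-suc i k)))))

pairs≡allPairs : ∀ w → pairs w ≡ allPairs w
pairs≡allPairs [] = refl
pairs≡allPairs (h ∷ t) =
  cong₂ _++_ (map-zip-applyUpTo _ h id 1 t (λ i b → cong (λ d → h , b , d) (+-comm 1 i))) (pairs≡allPairs t)

indexed≡positionsFrom : ∀ w → indexed w ≡ positionsFrom 1 w
indexed≡positionsFrom w = trans (cong (λ l → zip l w) (map-applyUpTo id suc (length w)))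
  (zip-applyUpTo suc 1 w (λ i → +-comm 1 i))

∈-positionsFrom : ∀ {k t j x} → (j , x) ∈ positionsFrom k t → x ∈ t
∈-positionsFrom {t = y ∷ t} (here refl) = here refl
∈-positionsFrom {t = y ∷ t} (there m) = there (∈-positionsFrom m)

∈-pairsFrom : ∀ {h k t a b d} → (a , b , d) ∈ pairsFrom h k t → a ≡ h × (d , b) ∈ positionsFrom k t
∈-pairsFrom {t = y ∷ t} (here refl) = refl , here refl
∈-pairsFrom {t = y ∷ t} (there m) = let (a≡h , m') = ∈-pairsFrom m in a≡h , there m'

∈-allPairs : ∀ {w a b d} → (a , b , d) ∈ allPairs w → a ∈ w × b ∈ w
∈-allPairs {h ∷ t} m with ∈-++⁻ (pairsFrom h 1 t) m
... | inj₁ m' = let (a≡h , m'') = ∈-pairsFrom m' in here a≡h , there (∈-positionsFrom m'')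
... | inj₂ m' = let (a∈t , b∈t) = ∈-allPairs {t} m' in there a∈t , there b∈t

Distinct : Window → Set
Distinct = AllPairs (λ x y → ∣ x ∣ ≢ ∣ y ∣)

-- posOdd w k: parity of the 0-based position of the first entry of w with
-- absolute value k
posOdd : Window → ℕ → Bool
posOdd [] k = false
posOdd (h ∷ t) k = if ∣ h ∣ ≡ᵇ k then false else not (posOdd t k)

posOdd-here : ∀ h t → posOdd (h ∷ t) ∣ h ∣ ≡ false
posOdd-here h t rewrite ≡ᵇ-refl ∣ h ∣ = refl

posOdd-there : ∀ h t k → ∣ h ∣ ≢ k → posOdd (h ∷ t) k ≡ not (posOdd t k)
posOdd-there h t k ne rewrite ≢⇒≡ᵇ-false ne = refl

posOdd-position : ∀ {t} k → Distinct t → ∀ {j x} → (j , x) ∈ positionsFrom k t →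
                  posOdd t ∣ x ∣ ≡ odd j xor odd k
posOdd-position {y ∷ t} k _ (here refl) = trans (posOdd-here y t) (sym (xor-same (odd k)))
posOdd-position {y ∷ t} k (y≢ ∷ dist) {j} {x} (there m) = begin
  posOdd (y ∷ t) ∣ x ∣           ≡⟨ posOdd-there y t ∣ x ∣ (All.lookup y≢ (∈-positionsFrom m)) ⟩
  not (posOdd t ∣ x ∣)           ≡⟨ cong not (posOdd-position (suc k) dist m) ⟩
  not (odd j xor not (odd k))    ≡⟨ not-distribʳ-xor (odd j) (not (odd k)) ⟩
  odd j xor not (not (odd k))    ≡⟨ cong (odd j xor_) (not-involutive (odd k)) ⟩
  odd j xor odd k                ∎
  where open ≡-Reasoning

distance-parity : ∀ {w} → Distinct w → ∀ {a b d} → (a , b , d) ∈ allPairs w →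
                  odd d ≡ posOdd w ∣ a ∣ xor posOdd w ∣ b ∣
distance-parity {h ∷ t} (h≢ ∷ dist) {a} {b} {d} m with ∈-++⁻ (pairsFrom h 1 t) m
... | inj₁ m' with ∈-pairsFrom m'
...   | refl , m'' = sym (begin
  posOdd (h ∷ t) ∣ h ∣ xor posOdd (h ∷ t) ∣ b ∣
    ≡⟨ cong₂ _xor_ (posOdd-here h t) (posOdd-there h t ∣ b ∣ (All.lookup h≢ (∈-positionsFrom m''))) ⟩
  not (posOdd t ∣ b ∣)                        ≡⟨ cong not (posOdd-position 1 dist m'') ⟩
  not (odd d xor true)                        ≡⟨ cong not (xor-true (odd d)) ⟩
  not (not (odd d))                           ≡⟨ not-involutive (odd d) ⟩
  odd d                                       ∎)
  where open ≡-Reasoning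
distance-parity {h ∷ t} (h≢ ∷ dist) {a} {b} {d} m | inj₂ m' with ∈-allPairs {t} m'
... | a∈t , b∈t = begin
  odd d                                         ≡⟨ distance-parity dist m' ⟩
  posOdd t ∣ a ∣ xor posOdd t ∣ b ∣             ≡⟨ xor-annihilates-not (posOdd t ∣ a ∣) (posOdd t ∣ b ∣) ⟨
  not (posOdd t ∣ a ∣) xor not (posOdd t ∣ b ∣) ≡⟨ cong₂ _xor_ (posOdd-there h t ∣ a ∣ (All.lookup h≢ a∈t))
                                                                (posOdd-there h t ∣ b ∣ (All.lookup h≢ b∈t)) ⟨
  posOdd (h ∷ t) ∣ a ∣ xor posOdd (h ∷ t) ∣ b ∣ ∎
  where open ≡-Reasoning

-- label w k: the parity of the value k agrees with the parity of its
-- (1-based) position in w.  Chessboard elements are those with all labels equal.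
label : Window → ℕ → Bool
label w k = odd k xor posOdd w k

label-at : ∀ {w} → Distinct w → ∀ {j x} → (j , x) ∈ positionsFrom 1 w → label w ∣ x ∣ ≡ sameParity x j
label-at {w} dist {j} {x} m = begin
  odd ∣ x ∣ xor posOdd w ∣ x ∣  ≡⟨ cong (odd ∣ x ∣ xor_) (trans (posOdd-position 1 dist m) (xor-true (odd j))) ⟩
  odd ∣ x ∣ xor not (odd j)     ≡⟨ not-distribʳ-xor (odd ∣ x ∣) (odd j) ⟨
  not (odd ∣ x ∣ xor odd j)     ≡⟨ sameParity≡ x j ⟨
  sameParity x j                ∎
  where open ≡-Reasoning

sameParity-suc : ∀ x j → sameParity x (suc j) ≡ not (sameParity x j)
sameParity-suc x j = trans (sameParity≡ x (suc j))
  (cong not (trans (sym (not-distribʳ-xor (odd ∣ x ∣) (odd j))) (sym (sameParity≡ x j))))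

allB-positionsFrom : ∀ (P : ℕ × ℤ → Bool) (Q : ℤ → Bool) k t →
  (∀ {j x} → (j , x) ∈ positionsFrom k t → P (j , x) ≡ Q x) → allB P (positionsFrom k t) ≡ allB Q t
allB-positionsFrom P Q k [] h = refl
allB-positionsFrom P Q k (x ∷ t) h = cong₂ _∧_ (h (here refl)) (allB-positionsFrom P Q (suc k) t (λ m → h (there m)))

chessboard⇔labels : ∀ w → Distinct w →
  isChessboard w ≡ allB (λ x → label w ∣ x ∣) w ∨ allB (λ x → not (label w ∣ x ∣)) w
chessboard⇔labels w dist rewrite indexed≡positionsFrom w = cong₂ _∨_
  (allB-positionsFrom _ _ 1 w (λ {j} {x} m → sym (label-at dist m)))
  (allB-positionsFrom _ _ 1 w (λ {j} {x} m → trans (sameParity-suc x j) (cong not (sym (label-at dist m)))))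

labelBreak : Window → ℕ → Bool
labelBreak w s = label w s xor label w (suc s)

labelBreak⇒posOdd≡ : ∀ w s → labelBreak w s ≡ true → posOdd w s ≡ posOdd w (suc s)
labelBreak⇒posOdd≡ w s e = equal-if-not-xor (posOdd w s) (posOdd w (suc s)) (begin
  not (posOdd w s xor posOdd w (suc s))                                ≡⟨⟩
  true xor (posOdd w s xor posOdd w (suc s))
    ≡⟨ cong (_xor (posOdd w s xor posOdd w (suc s))) (odd-xor-odd-suc s) ⟨
  (odd s xor odd (suc s)) xor (posOdd w s xor posOdd w (suc s))
    ≡⟨ xor-interchange (odd s) (odd (suc s)) (posOdd w s) (posOdd w (suc s)) ⟩
  labelBreak w s                                                       ≡⟨ e ⟩
  true                                                                 ∎)
  where
  open ≡-Reasoning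
  equal-if-not-xor : ∀ p q → not (p xor q) ≡ true → p ≡ q
  equal-if-not-xor true true _ = refl
  equal-if-not-xor false false _ = refl

posOdd-swapAbs : ∀ u w k → posOdd (map (swapAbs u) w) k ≡ posOdd w (swap (suc u) k)
posOdd-swapAbs u [] k = refl
posOdd-swapAbs u (h ∷ t) k
  rewrite ∣swapAbs∣ u h | swap-≡ᵇ (suc u) ∣ h ∣ k | posOdd-swapAbs u t k = refl

posOdd-swapAbs-invariant : ∀ u w → labelBreak w (suc u) ≡ true →
                           ∀ k → posOdd (map (swapAbs u) w) k ≡ posOdd w k
posOdd-swapAbs-invariant u w e k =
  trans (posOdd-swapAbs u w k) (swap-invariant (posOdd w) (suc u) (labelBreak⇒posOdd≡ w (suc u) e) k)

label-swapAbs : ∀ u w → labelBreak w (suc u) ≡ true → ∀ k → label (map (swapAbs u) w) k ≡ label w k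
label-swapAbs u w e k = cong (odd k xor_) (posOdd-swapAbs-invariant u w e k)

onPair : (ℤ → ℤ) → ℤ × ℤ × ℕ → ℤ × ℤ × ℕ
onPair f (a , b , d) = (f a , f b , d)

allPairs-map : ∀ (f : ℤ → ℤ) w → allPairs (map f w) ≡ map (onPair f) (allPairs w)
allPairs-map f [] = refl
allPairs-map f (h ∷ t) = begin
  pairsFrom (f h) 1 (map f t) ++ allPairs (map f t)        ≡⟨ cong₂ _++_ (pairsFrom-map 1 t) (allPairs-map f t) ⟩
  map (onPair f) (pairsFrom h 1 t) ++ map (onPair f) (allPairs t) ≡⟨ map-++ (onPair f) (pairsFrom h 1 t) (allPairs t) ⟨
  map (onPair f) (pairsFrom h 1 t ++ allPairs t)           ∎
  where
  open ≡-Reasoning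
  pairsFrom-map : ∀ k t → pairsFrom (f h) k (map f t) ≡ map (onPair f) (pairsFrom h k t)
  pairsFrom-map k [] = refl
  pairsFrom-map k (x ∷ t) = cong (_ ∷_) (pairsFrom-map (suc k) t)

crossing-pair-even : ∀ u w → Distinct w → labelBreak w (suc u) ≡ true →
  ∀ {a b d} → (a , b , d) ∈ allPairs w → crosses (suc u) ∣ a ∣ ∣ b ∣ ≡ true → isEvenB d ≡ true
crossing-pair-even u w dist e {a} {b} {d} m c =
  trans (isEvenB≡not-odd d) (cong not (trans (distance-parity dist m) samePositions))
  where
  equalPositions : posOdd w (suc u) ≡ posOdd w (suc (suc u))
  equalPositions = labelBreak⇒posOdd≡ w (suc u) e

  samePositions : posOdd w ∣ a ∣ xor posOdd w ∣ b ∣ ≡ false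
  samePositions with crosses-true (suc u) ∣ a ∣ ∣ b ∣ c
  ... | inj₁ (p , q) = trans (cong₂ (λ x y → posOdd w x xor posOdd w y) p q) (≡⇒xor-false equalPositions)
  ... | inj₂ (p , q) = trans (cong₂ (λ x y → posOdd w x xor posOdd w y) p q) (≡⇒xor-false (sym equalPositions))

oddPairStat-swapAbs : ∀ (P : ℤ × ℤ × ℕ → Bool) u w → Distinct w → labelBreak w (suc u) ≡ true →
  (∀ a b d → isEvenB d ≡ true → P (a , b , d) ≡ false) →
  (∀ a b d → crosses (suc u) ∣ a ∣ ∣ b ∣ ≡ false → P (swapAbs u a , swapAbs u b , d) ≡ P (a , b , d)) →
  countB P (pairs (map (swapAbs u) w)) ≡ countB P (pairs w)
oddPairStat-swapAbs P u w dist e even-vanishes keeps = begin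
  countB P (pairs (map (swapAbs u) w))
    ≡⟨ cong (countB P) (trans (pairs≡allPairs (map (swapAbs u) w)) (allPairs-map (swapAbs u) w)) ⟩
  countB P (map (onPair (swapAbs u)) (allPairs w))  ≡⟨ countB-map P (onPair (swapAbs u)) (allPairs w) ⟩
  countB (λ p → P (onPair (swapAbs u) p)) (allPairs w)
    ≡⟨ countB-cong (λ p → P (onPair (swapAbs u) p)) P (allPairs w) pointwise ⟩
  countB P (allPairs w)                             ≡⟨ cong (countB P) (pairs≡allPairs w) ⟨
  countB P (pairs w)                                ∎
  where
  open ≡-Reasoning
  pointwise : ∀ {p} → p ∈ allPairs w → P (onPair (swapAbs u) p) ≡ P p
  pointwise {a , b , d} m with crosses (suc u) ∣ a ∣ ∣ b ∣ in c
  ... | false = keeps a b d c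
  ... | true = let ev = crossing-pair-even u w dist e m c in
               trans (even-vanishes (swapAbs u a) (swapAbs u b) d ev) (sym (even-vanishes a b d ev))

oinv-swapAbs : ∀ u w → Distinct w → labelBreak w (suc u) ≡ true → oinv (map (swapAbs u) w) ≡ oinv w
oinv-swapAbs u w dist e = oddPairStat-swapAbs _ u w dist e
  (λ a b d ev → trans (cong (λ z → gtB a b ∧ not z) ev) (∧-zeroʳ (gtB a b)))
  (λ a b d c → cong (_∧ not (isEvenB d)) (gtB-swapAbs u a b c))

onsp-swapAbs : ∀ u w → Distinct w → labelBreak w (suc u) ≡ true → onsp (map (swapAbs u) w) ≡ onsp w
onsp-swapAbs u w dist e = oddPairStat-swapAbs _ u w dist e
  (λ a b d ev → trans (cong (λ z → negB (a ℤ.+ b) ∧ not z) ev) (∧-zeroʳ (negB (a ℤ.+ b))))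
  (λ a b d c → cong (_∧ not (isEvenB d)) (negSumB-swapAbs u a b c))

countAbs : ℕ → Window → ℕ
countAbs k w = countB (λ x → ∣ x ∣ ≡ᵇ k) w

inversionPair : ℤ × ℤ × ℕ → Bool
inversionPair (a , b , d) = inversionTest a b

ℓD-parity : ∀ v → isEvenB (ℓD v) ≡ not (xorSum inversionPair (allPairs v))
ℓD-parity v = trans (isEvenB≡not-odd (ℓD v)) (cong not (begin
  odd (inv v + nsp v)                                 ≡⟨ odd-+ (inv v) (nsp v) ⟩
  odd (inv v) xor odd (nsp v)                         ≡⟨ cong₂ _xor_ oddInv oddNsp ⟩
  xorSum gtPair (pairs v) xor xorSum negPair (pairs v) ≡⟨ xorSum-xor gtPair negPair (pairs v) ⟨
  xorSum inversionPair (pairs v)                      ≡⟨ cong (xorSum inversionPair) (pairs≡allPairs v) ⟩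
  xorSum inversionPair (allPairs v)                   ∎))
  where
  open ≡-Reasoning
  gtPair negPair : ℤ × ℤ × ℕ → Bool
  gtPair (a , b , d) = gtB a b
  negPair (a , b , d) = negB (a ℤ.+ b)

  oddInv : odd (inv v) ≡ xorSum gtPair (pairs v)
  oddInv = trans (odd-countB _ (pairs v)) (xorSum-cong _ gtPair (pairs v) λ { (a , b , d) → refl })

  oddNsp : odd (nsp v) ≡ xorSum negPair (pairs v)
  oddNsp = trans (odd-countB _ (pairs v)) (xorSum-cong _ negPair (pairs v) λ { (a , b , d) → refl })

crossingPair : ℕ → ℤ × ℤ × ℕ → Bool
crossingPair s (a , b , d) = crosses s ∣ a ∣ ∣ b ∣

-- The number of pairs carrying the values s and s+1 is
-- countAbs s w · countAbs (s+1) w; we need it modulo 2.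
crossings-parity : ∀ s w →
  xorSum (crossingPair s) (allPairs w) ≡ odd (countAbs s w) ∧ odd (countAbs (suc s) w)
crossings-parity s [] = refl
crossings-parity s (h ∷ t) = begin
  xorSum (crossingPair s) (pairsFrom h 1 t ++ allPairs t)
    ≡⟨ xorSum-++ (crossingPair s) (pairsFrom h 1 t) (allPairs t) ⟩
  xorSum (crossingPair s) (pairsFrom h 1 t) xor xorSum (crossingPair s) (allPairs t)
      ≡⟨ cong₂ _xor_ (trans (fromHead 1 t) linear) (crossings-parity s t) ⟩
  ((A ∧ Y) xor (A′ ∧ X)) xor (X ∧ Y)                               ≡⟨ xor-product-rule A A′ X Y (≡ᵇ-exclusive ∣ h ∣ s) ⟩
  (A xor X) ∧ (A′ xor Y)
    ≡⟨ cong₂ _∧_ (odd-countB-∷ (λ x → ∣ x ∣ ≡ᵇ s) h t) (odd-countB-∷ (λ x → ∣ x ∣ ≡ᵇ suc s) h t) ⟨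
  odd (countAbs s (h ∷ t)) ∧ odd (countAbs (suc s) (h ∷ t))        ∎
  where
  open ≡-Reasoning
  A A′ X Y : Bool
  A = ∣ h ∣ ≡ᵇ s
  A′ = ∣ h ∣ ≡ᵇ suc s
  X = odd (countAbs s t)
  Y = odd (countAbs (suc s) t)

  fromHead : ∀ k t → xorSum (crossingPair s) (pairsFrom h k t) ≡ xorSum (λ x → crosses s ∣ h ∣ ∣ x ∣) t
  fromHead k [] = refl
  fromHead k (x ∷ t) = cong (crosses s ∣ h ∣ ∣ x ∣ xor_) (fromHead (suc k) t)

  linear : xorSum (λ x → crosses s ∣ h ∣ ∣ x ∣) t ≡ (A ∧ Y) xor (A′ ∧ X)
  linear = trans (xorSum-xor (λ x → A ∧ (∣ x ∣ ≡ᵇ suc s)) (λ x → A′ ∧ (∣ x ∣ ≡ᵇ s)) t)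
    (cong₂ _xor_ (trans (xorSum-∧ˡ A (λ x → ∣ x ∣ ≡ᵇ suc s) t)
                        (cong (A ∧_) (sym (odd-countB (λ x → ∣ x ∣ ≡ᵇ suc s) t))))
                 (trans (xorSum-∧ˡ A′ (λ x → ∣ x ∣ ≡ᵇ s) t)
                        (cong (A′ ∧_) (sym (odd-countB (λ x → ∣ x ∣ ≡ᵇ s) t)))))

ℓD-swapAbs : ∀ u w → countAbs (suc u) w ≡ 1 → countAbs (suc (suc u)) w ≡ 1 →
             isEvenB (ℓD (map (swapAbs u) w)) ≡ not (isEvenB (ℓD w))
ℓD-swapAbs u w once₁ once₂ = begin
  isEvenB (ℓD (map (swapAbs u) w))                                   ≡⟨ ℓD-parity (map (swapAbs u) w) ⟩
  not (xorSum inversionPair (allPairs (map (swapAbs u) w)))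
    ≡⟨ cong (λ ps → not (xorSum inversionPair ps)) (allPairs-map (swapAbs u) w) ⟩
  not (xorSum inversionPair (map (onPair (swapAbs u)) (allPairs w)))
    ≡⟨ cong not (xorSum-map inversionPair (onPair (swapAbs u)) (allPairs w)) ⟩
  not (xorSum (λ p → inversionPair (onPair (swapAbs u) p)) (allPairs w))
      ≡⟨ cong not (xorSum-cong _ _ (allPairs w) λ { (a , b , d) → inversionTest-swapAbs u a b }) ⟩
  not (xorSum (λ p → crossingPair (suc u) p xor inversionPair p) (allPairs w))
      ≡⟨ cong not (xorSum-xor (crossingPair (suc u)) inversionPair (allPairs w)) ⟩
  not (xorSum (crossingPair (suc u)) (allPairs w) xor xorSum inversionPair (allPairs w))
      ≡⟨ cong (λ c → not (c xor xorSum inversionPair (allPairs w))) oneCrossing ⟩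
  not (not (xorSum inversionPair (allPairs w)))                      ≡⟨ cong not (ℓD-parity w) ⟨
  not (isEvenB (ℓD w))                                               ∎
  where
  open ≡-Reasoning
  oneCrossing : xorSum (crossingPair (suc u)) (allPairs w) ≡ true
  oneCrossing = trans (crossings-parity (suc u) w) (cong₂ (λ p q → odd p ∧ odd q) once₁ once₂)

isDn⇒ : ∀ n w → isDn n w ≡ true →
  length w ≡ n × (∀ i → i < n → countAbs (suc i) w ≡ 1) × isEvenB (countB negB w) ≡ true
isDn⇒ n w e with length w ≡ᵇ n in len | allB (λ i → countAbs (suc i) w ≡ᵇ 1) (upTo n) in all | isEvenB (countB negB w) in ev
... | true | true | true = ≡ᵇ-true len , (λ i i<n → ≡ᵇ-true (allB-true⁻ _ (upTo n) all (∈-upTo⁺ i<n))) , refl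

isDn⇐ : ∀ n w → length w ≡ n → (∀ i → i < n → countAbs (suc i) w ≡ 1) → isEvenB (countB negB w) ≡ true →
        isDn n w ≡ true
isDn⇐ n w len once ev =
  cong₂ _∧_ (cong₂ _∧_ (trans (cong (_≡ᵇ n) len) (≡ᵇ-refl n)) (allB-true⁺ _ (upTo n) counts)) ev
  where
  counts : ∀ {i} → i ∈ upTo n → (countAbs (suc i) w ≡ᵇ 1) ≡ true
  counts {i} m = cong (_≡ᵇ 1) (once i (∈-upTo⁻ m))

InRange : ℕ → ℕ → Set
InRange n m = Σ ℕ λ i → i < n × m ≡ suc i

hits : ℕ → ℕ → ℕ
hits zero m = 0
hits (suc n) m = (if m ≡ᵇ suc n then 1 else 0) + hits n m

hits-above : ∀ n m → n < m → hits n m ≡ 0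
hits-above zero m n<m = refl
hits-above (suc n) m n<m rewrite ≢⇒≡ᵇ-false {m} {suc n} (λ e → <-irrefl (sym e) n<m) =
  hits-above n m (≤-trans (n≤1+n (suc n)) n<m)

hits-≤1 : ∀ n m → hits n m ≤ 1
hits-≤1 zero m = z≤n
hits-≤1 (suc n) m with m ≡ᵇ suc n in e
... | true = s≤s (≤-reflexive (trans (cong (hits n) (≡ᵇ-true e)) (hits-above n (suc n) ≤-refl)))
... | false = hits-≤1 n m

hits≡1⇒InRange : ∀ n m → hits n m ≡ 1 → InRange n m
hits≡1⇒InRange (suc n) m h with m ≡ᵇ suc n in e
... | true = n , ≤-refl , ≡ᵇ-true e
... | false = let (i , i<n , m≡) = hits≡1⇒InRange n m h in i , ≤-trans i<n (n≤1+n n) , m≡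

-- totalCount n w = Σ_{i<n} countAbs (i+1) w counts the entries of w with
-- absolute value in [n]; it reaches length w only if every entry does.
totalCount : ℕ → Window → ℕ
totalCount zero w = 0
totalCount (suc n) w = countAbs (suc n) w + totalCount n w

totalCount-∷ : ∀ n h t → totalCount n (h ∷ t) ≡ hits n ∣ h ∣ + totalCount n t
totalCount-∷ zero h t = refl
totalCount-∷ (suc n) h t = begin
  countAbs (suc n) (h ∷ t) + totalCount n (h ∷ t)
    ≡⟨ cong₂ _+_ (countB-∷ (λ x → ∣ x ∣ ≡ᵇ suc n) h t) (totalCount-∷ n h t) ⟩
  (b + countAbs (suc n) t) + (hits n ∣ h ∣ + totalCount n t)
    ≡⟨ +-interchange b (countAbs (suc n) t) (hits n ∣ h ∣) (totalCount n t) ⟩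
  (b + hits n ∣ h ∣) + (countAbs (suc n) t + totalCount n t) ∎
  where
  open ≡-Reasoning
  b = if ∣ h ∣ ≡ᵇ suc n then 1 else 0

totalCount-≤ : ∀ n w → totalCount n w ≤ length w
totalCount-≤ zero w = z≤n
totalCount-≤ (suc n) [] = totalCount-≤ n []
totalCount-≤ (suc n) (h ∷ t) rewrite totalCount-∷ (suc n) h t = +-mono-≤ (hits-≤1 (suc n) ∣ h ∣) (totalCount-≤ (suc n) t)

totalCount≡length⇒ : ∀ n w → totalCount n w ≡ length w → All (λ x → hits n ∣ x ∣ ≡ 1) w
totalCount≡length⇒ n [] e = []
totalCount≡length⇒ n (h ∷ t) e rewrite totalCount-∷ n h t with hits n ∣ h ∣ in hit | hits-≤1 n ∣ h ∣
... | zero | _ = ⊥-elim (<-irrefl refl (subst (_≤ length t) e (totalCount-≤ n t)))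
... | suc zero | _ = hit ∷ totalCount≡length⇒ n t (suc-injective e)
... | suc (suc _) | s≤s ()

totalCount-once : ∀ n w → (∀ i → i < n → countAbs (suc i) w ≡ 1) → totalCount n w ≡ n
totalCount-once zero w once = refl
totalCount-once (suc n) w once rewrite once n ≤-refl =
  cong suc (totalCount-once n w (λ i i<n → once i (≤-trans i<n (n≤1+n n))))

once⇒distinct : ∀ n w → (∀ i → i < n → countAbs (suc i) w ≤ 1) → All (λ x → InRange n ∣ x ∣) w → Distinct w
once⇒distinct n [] atMostOnce inRange = []
once⇒distinct n (h ∷ t) atMostOnce ((i , i<n , h≡) ∷ inRange) =
  All.tabulate collision ∷ once⇒distinct n t (λ j j<n → ≤-trans (countB-≤-∷ _ h t) (atMostOnce j j<n)) inRange
  where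
  hasValue : ∀ {x} → ∣ x ∣ ≡ ∣ h ∣ → (∣ x ∣ ≡ᵇ suc i) ≡ true
  hasValue e = trans (cong (_≡ᵇ suc i) (trans e h≡)) (≡ᵇ-refl (suc i))

  collision : ∀ {y} → y ∈ t → ∣ h ∣ ≢ ∣ y ∣
  collision {y} y∈t e with atMostOnce i i<n
  ... | bound rewrite countB-∷ (λ x → ∣ x ∣ ≡ᵇ suc i) h t | hasValue {h} refl
        with ≤-trans (s≤s (countB-positive (λ x → ∣ x ∣ ≡ᵇ suc i) t y∈t (hasValue {y} (sym e)))) bound
  ...   | s≤s ()

record SignedPerm (n : ℕ) (w : Window) : Set where
  field
    length≡ : length w ≡ n
    once : ∀ i → i < n → countAbs (suc i) w ≡ 1
    evenNegatives : isEvenB (countB negB w) ≡ true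
    inRange : All (λ x → InRange n ∣ x ∣) w
    distinct : Distinct w

isDn⇒SignedPerm : ∀ n w → isDn n w ≡ true → SignedPerm n w
isDn⇒SignedPerm n w e = record
  { length≡ = length≡
  ; once = once
  ; evenNegatives = evenNegatives
  ; inRange = inRange
  ; distinct = once⇒distinct n w (λ i i<n → ≤-reflexive (once i i<n)) inRange
  }
  where
  length≡ = proj₁ (isDn⇒ n w e)
  once = proj₁ (proj₂ (isDn⇒ n w e))
  evenNegatives = proj₂ (proj₂ (isDn⇒ n w e))
  inRange : All (λ x → InRange n ∣ x ∣) w
  inRange = All.map (λ {x} → hits≡1⇒InRange n ∣ x ∣)
                    (totalCount≡length⇒ n w (trans (totalCount-once n w once) (sym length≡)))

present : ∀ {n w} → SignedPerm n w → ∀ i → i < n → Σ ℤ λ x → x ∈ w × ∣ x ∣ ≡ suc i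
present {n} {w} σ i i<n =
  let (x , x∈w , hit) = countB-witness (λ x → ∣ x ∣ ≡ᵇ suc i) w (≤-reflexive (sym (SignedPerm.once σ i i<n)))
  in x , x∈w , ≡ᵇ-true hit

allB-values : ∀ {n w} → SignedPerm n w → ∀ (f : ℕ → Bool) →
              allB (λ x → f ∣ x ∣) w ≡ allB (λ i → f (suc i)) (upTo n)
allB-values {n} {w} σ f = ⇔→≡ {z = true} (mk⇔ entries⇒values values⇒entries)
  where
  entries⇒values : allB (λ x → f ∣ x ∣) w ≡ true → allB (λ i → f (suc i)) (upTo n) ≡ true
  entries⇒values e = allB-true⁺ _ (upTo n) λ {i} m →
    let (x , x∈w , x≡) = present σ i (∈-upTo⁻ m) in subst (λ k → f k ≡ true) x≡ (allB-true⁻ _ w e x∈w)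

  values⇒entries : allB (λ i → f (suc i)) (upTo n) ≡ true → allB (λ x → f ∣ x ∣) w ≡ true
  values⇒entries e = allB-true⁺ _ w λ {x} m →
    let (i , i<n , x≡) = All.lookup (SignedPerm.inRange σ) m in
    subst (λ k → f k ≡ true) (sym x≡) (allB-true⁻ _ (upTo n) e (∈-upTo⁺ i<n))

labelsConstant : ℕ → Window → Bool
labelsConstant n w = allB (λ i → label w (suc i)) (upTo n) ∨ allB (λ i → not (label w (suc i))) (upTo n)

chessboard≡labelsConstant : ∀ {n w} → SignedPerm n w → isChessboard w ≡ labelsConstant n w
chessboard≡labelsConstant {n} {w} σ = trans (chessboard⇔labels w (SignedPerm.distinct σ))
  (cong₂ _∨_ (allB-values σ (label w)) (allB-values σ (λ k → not (label w k))))

noBreak⇒labelsConstant : ∀ n w → (∀ u → suc u < n → labelBreak w (suc u) ≡ false) → labelsConstant n w ≡ true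
noBreak⇒labelsConstant n w noBreak = byLabelOf1 (label w 1) refl
  where
  equal-if-xor-false : ∀ p q → p xor q ≡ false → q ≡ p
  equal-if-xor-false true true _ = refl
  equal-if-xor-false false false _ = refl

  labelOf1 : ∀ i → i < n → label w (suc i) ≡ label w 1
  labelOf1 zero i<n = refl
  labelOf1 (suc i) i<n = trans (equal-if-xor-false _ _ (noBreak i i<n)) (labelOf1 i (≤-trans (n≤1+n (suc i)) i<n))

  byLabelOf1 : ∀ b → label w 1 ≡ b → labelsConstant n w ≡ true
  byLabelOf1 true l₁ = cong (_∨ allB (λ i → not (label w (suc i))) (upTo n))
                            (allB-true⁺ _ (upTo n) λ {i} m → trans (labelOf1 i (∈-upTo⁻ m)) l₁)
  byLabelOf1 false l₁ =
    trans (cong (allB (λ i → label w (suc i)) (upTo n) ∨_)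
                (allB-true⁺ _ (upTo n) λ {i} m → cong not (trans (labelOf1 i (∈-upTo⁻ m)) l₁)))
          (∨-zeroʳ (allB (λ i → label w (suc i)) (upTo n)))

module _ {A : Set} where

  findᵇ-just : ∀ (p : A → Bool) xs {y} → findᵇ p xs ≡ just y → y ∈ xs × p y ≡ true
  findᵇ-just p (x ∷ xs) e with p x in px
  findᵇ-just p (x ∷ xs) refl | true = here refl , px
  ... | false = let (m , py) = findᵇ-just p xs e in there m , py

  findᵇ-nothing : ∀ (p : A → Bool) xs → findᵇ p xs ≡ nothing → ∀ {y} → y ∈ xs → p y ≡ false
  findᵇ-nothing p (x ∷ xs) e m with p x in px
  findᵇ-nothing p (x ∷ xs) () m | true
  findᵇ-nothing p (x ∷ xs) e (here refl) | false = px
  findᵇ-nothing p (x ∷ xs) e (there m) | false = findᵇ-nothing p xs e m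

  findᵇ-cong : ∀ (p q : A → Bool) xs → (∀ x → p x ≡ q x) → findᵇ p xs ≡ findᵇ q xs
  findᵇ-cong p q [] h = refl
  findᵇ-cong p q (x ∷ xs) h rewrite h x | findᵇ-cong p q xs h = refl

map-fixes : ∀ {A : Set} (f : A → A) xs → map f xs ≡ xs → ∀ {x} → x ∈ xs → f x ≡ x
map-fixes f (y ∷ ys) e (here refl) = ∷-injectiveˡ e
map-fixes f (y ∷ ys) e (there m) = map-fixes f ys (∷-injectiveʳ e) m

firstBreak : ℕ → Window → Maybe ℕ
firstBreak n w = findᵇ (λ u → labelBreak w (suc u)) (upTo (ℕ.pred n))

flipAt : Maybe ℕ → Window → Window
flipAt nothing w = w
flipAt (just u) w = map (swapAbs u) w

involution : ℕ → Window → Window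
involution n w = flipAt (firstBreak n w) w

suc<⇒<pred : ∀ n {u} → suc u < n → u < ℕ.pred n
suc<⇒<pred (suc n) (s≤s u<n) = u<n

<pred⇒suc< : ∀ n {u} → u < ℕ.pred n → suc u < n
<pred⇒suc< (suc n) u<n = s≤s u<n

record Break (n : ℕ) (w : Window) : Set where
  field
    u : ℕ
    found : firstBreak n w ≡ just u
    bound : suc u < n
    differs : labelBreak w (suc u) ≡ true

findBreak : ∀ {n w} → SignedPerm n w → isChessboard w ≡ false → Break n w
findBreak {n} {w} σ notChess with firstBreak n w in e
... | just u = let (m , differs) = findᵇ-just _ (upTo (ℕ.pred n)) e in
               record { u = u ; found = e ; bound = <pred⇒suc< n (∈-upTo⁻ m) ; differs = differs }
... | nothing = ⊥-elim (false≢true (begin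
  false                ≡⟨ notChess ⟨
  isChessboard w       ≡⟨ chessboard≡labelsConstant σ ⟩
  labelsConstant n w   ≡⟨ noBreak⇒labelsConstant n w (λ u u<n → findᵇ-nothing _ _ e (∈-upTo⁺ (suc<⇒<pred n u<n))) ⟩
  true                 ∎))
  where
  open ≡-Reasoning
  false≢true : false ≢ true
  false≢true ()

countAbs-swapAbs : ∀ u w k → countAbs k (map (swapAbs u) w) ≡ countAbs (swap (suc u) k) w
countAbs-swapAbs u w k = trans (countB-map (λ x → ∣ x ∣ ≡ᵇ k) (swapAbs u) w)
  (countB-cong _ _ w λ {x} _ → trans (cong (_≡ᵇ k) (∣swapAbs∣ u x)) (swap-≡ᵇ (suc u) ∣ x ∣ k))

module _ {n w} (σ : SignedPerm n w) (b : Break n w) where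
  open Break b
  open SignedPerm σ

  involution≡ : involution n w ≡ map (swapAbs u) w
  involution≡ = cong (λ m → flipAt m w) found

  involution-isDn : isDn n (involution n w) ≡ true
  involution-isDn rewrite involution≡ = isDn⇐ n (map (swapAbs u) w)
    (trans (length-map (swapAbs u) w) length≡)
    (λ i i<n → trans (countAbs-swapAbs u w (suc i)) (once (swap u i) (swap-< u i n i<n bound)))
    (trans (cong isEvenB (trans (countB-map negB (swapAbs u) w) (countB-cong _ negB w λ {x} _ → negB-swapAbs u x)))
           evenNegatives)

  private
    σ′ : SignedPerm n (map (swapAbs u) w)
    σ′ = isDn⇒SignedPerm n _ (subst (λ v → isDn n v ≡ true) involution≡ involution-isDn)

    labels : ∀ k → label (map (swapAbs u) w) k ≡ label w k
    labels = label-swapAbs u w differs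

  involution-chessboard : isChessboard (involution n w) ≡ isChessboard w
  involution-chessboard rewrite involution≡ = begin
    isChessboard (map (swapAbs u) w)        ≡⟨ chessboard≡labelsConstant σ′ ⟩
    labelsConstant n (map (swapAbs u) w)    ≡⟨ cong₂ _∨_ (allB-cong _ _ (upTo n) λ i → labels (suc i))
                                                           (allB-cong _ _ (upTo n) λ i → cong not (labels (suc i))) ⟩
    labelsConstant n w                      ≡⟨ chessboard≡labelsConstant σ ⟨
    isChessboard w                          ∎
    where open ≡-Reasoning

  -- the labels, hence the first break, are unchanged, so the same swap undoes it
  involution-involutive : involution n (involution n w) ≡ w
  involution-involutive rewrite involution≡ = begin
    flipAt (firstBreak n (map (swapAbs u) w)) (map (swapAbs u) w)
      ≡⟨ cong (λ m → flipAt m (map (swapAbs u) w)) (trans sameBreaks found) ⟩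
    map (swapAbs u) (map (swapAbs u) w)   ≡⟨ map-∘ w ⟨
    map (swapAbs u ∘ swapAbs u) w         ≡⟨ map-cong (swapAbs-involutive u) w ⟩
    map id w                              ≡⟨ map-id w ⟩
    w                                     ∎
    where
    open ≡-Reasoning
    sameBreaks : firstBreak n (map (swapAbs u) w) ≡ firstBreak n w
    sameBreaks = findᵇ-cong _ _ (upTo (ℕ.pred n)) λ u′ → cong₂ _xor_ (labels (suc u′)) (labels (suc (suc u′)))

  -- the value u+1 occurs and is moved, so w is not a fixed point
  involution-moves : involution n w ≢ w
  involution-moves fixed with present σ u (≤-trans (n≤1+n (suc u)) bound)
  ... | x , x∈w , x≡ = 1+n≢n (begin
    suc (suc u)           ≡⟨ swap-s (suc u) ⟨
    swap (suc u) (suc u)  ≡⟨ cong (swap (suc u)) x≡ ⟨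
    swap (suc u) ∣ x ∣    ≡⟨ ∣swapAbs∣ u x ⟨
    ∣ swapAbs u x ∣       ≡⟨ cong ∣_∣ (map-fixes (swapAbs u) w (trans (sym involution≡) fixed) x∈w) ⟩
    ∣ x ∣                 ≡⟨ x≡ ⟩
    suc u                 ∎)
    where open ≡-Reasoning

  involution-oinv : oinv (involution n w) ≡ oinv w
  involution-oinv rewrite involution≡ = oinv-swapAbs u w distinct differs

  involution-onsp : onsp (involution n w) ≡ onsp w
  involution-onsp rewrite involution≡ = onsp-swapAbs u w distinct differs

  involution-sign : signPow (ℓD (involution n w)) ≡ ℤ.- signPow (ℓD w)
  involution-sign rewrite involution≡ = signPow-flip (ℓD w) (ℓD (map (swapAbs u) w))
    (ℓD-swapAbs u w (once u (≤-trans (n≤1+n (suc u)) bound)) (once (suc u) bound))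

-- The enumeration words n k lists every window of length k with entries in
-- [-n, n] exactly once, so D_n and its sublists are duplicate-free.
range-complete : ∀ n y → ∣ y ∣ ≤ n → y ∈ range n
range-complete n (ℤ.+ m) m≤n = subst (_∈ range n) shifted
  (∈-map⁺ (λ k → ℤ.+ k ℤ.- ℤ.+ n) (∈-upTo⁺ (s≤s (+-monoˡ-≤ n m≤n))))
  where
  shifted : ℤ.+ (m + n) ℤ.- ℤ.+ n ≡ ℤ.+ m
  shifted = trans (m-n≡m⊖n (m + n) n) (trans (⊖-≥ (m≤n+m n m)) (cong ℤ.+_ (m+n∸n≡m m n)))
range-complete (suc n) -[1+ m ] (s≤s m≤n) = subst (_∈ range (suc n)) shifted
  (∈-map⁺ (λ k → ℤ.+ k ℤ.- ℤ.+ suc n)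
          (∈-upTo⁺ (s≤s (≤-trans (≤-trans (m∸n≤m n m) (n≤1+n n)) (m≤m+n (suc n) (suc n))))))
  where
  shifted : ℤ.+ (n ∸ m) ℤ.- ℤ.+ suc n ≡ -[1+ m ]
  shifted = trans (m-n≡m⊖n (n ∸ m) (suc n))
    (trans (⊖-< (s≤s (m∸n≤m n m))) (cong (λ k → ℤ.- ℤ.+ k) (m∸[m∸n]≡n {suc n} {suc m} (s≤s m≤n))))

words-complete : ∀ n k v → length v ≡ k → All (λ y → ∣ y ∣ ≤ n) v → v ∈ words n k
words-complete n zero [] _ _ = here refl
words-complete n (suc k) (y ∷ v) len (y≤n ∷ v≤n) =
  ∈-concat⁺′ (∈-map⁺ (_∷ v) (range-complete n y y≤n)) (∈-map⁺ _ (words-complete n k v (suc-injective len) v≤n))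

signedPerm∈words : ∀ {n v} → SignedPerm n v → v ∈ words n n
signedPerm∈words {n} {v} σ = words-complete n n v (SignedPerm.length≡ σ)
  (All.map (λ { (i , i<n , x≡) → subst (_≤ n) (sym x≡) i<n }) (SignedPerm.inRange σ))

range-unique : ∀ n → Unique (range n)
range-unique n = Unique.map⁺ shift-injective (Unique.upTo⁺ (suc (n + n)))
  where
  shift-injective : ∀ {k k′} → ℤ.+ k ℤ.- ℤ.+ n ≡ ℤ.+ k′ ℤ.- ℤ.+ n → k ≡ k′
  shift-injective e = +-injective (∙-cancelʳ (ℤ.- ℤ.+ n) _ _ e)

words-unique : ∀ n k → Unique (words n k)
words-unique n zero = [] ∷ []
words-unique n (suc k) = Unique.concat⁺
  (All.map⁺ (All.universal (λ v → Unique.map⁺ ∷-injectiveˡ (range-unique n)) (words n k)))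
  (AllPairs.map⁺ (AllPairs.map disjoint (words-unique n k)))
  where
  disjoint : ∀ {v v′} → v ≢ v′ → Disjoint (map (_∷ v) (range n)) (map (_∷ v′) (range n))
  disjoint v≢v′ (m , m′) with ∈-map⁻ (_∷ _) m | ∈-map⁻ (_∷ _) m′
  ... | _ , _ , refl | _ , _ , e = v≢v′ (∷-injectiveʳ e)

-- filterB is the library filter for T ∘ p, which keeps a list duplicate-free
filterB-unique : ∀ {A : Set} (p : A → Bool) xs → Unique xs → Unique (filterB p xs)
filterB-unique p xs u = subst Unique (sym (filterB≡filterᵇ xs)) (Unique.filter⁺ (T? ∘ p) u)
  where
  filterB≡filterᵇ : ∀ xs → filterB p xs ≡ filterᵇ p xs
  filterB≡filterᵇ [] = refl
  filterB≡filterᵇ (x ∷ xs) with p x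
  ... | true = cong (x ∷_) (filterB≡filterᵇ xs)
  ... | false = filterB≡filterᵇ xs

sumℤ : List ℤ → ℤ
sumℤ = foldr ℤ._+_ (ℤ.+ 0)

sum-split : ∀ {A : Set} (C K : A → Bool) (g : A → ℤ) xs →
  sumℤ (map g (filterB K xs)) ≡
  sumℤ (map g (filterB K (filterB C xs))) ℤ.+ sumℤ (map g (filterB K (filterB (λ x → not (C x)) xs)))
sum-split C K g [] = refl
sum-split C K g (x ∷ xs) with C x
... | true with K x
...   | true = trans (cong (λ s → g x ℤ.+ s) (sum-split C K g xs))
                     (sym (ℤP.+-assoc (g x) (sumℤ (map g (filterB K (filterB C xs))))
                                            (sumℤ (map g (filterB K (filterB (λ x → not (C x)) xs))))))
...   | false = sum-split C K g xs
sum-split C K g (x ∷ xs) | false with K x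
...   | true = trans (cong (λ s → g x ℤ.+ s) (sum-split C K g xs))
                     (x∙yz≈y∙xz (g x) (sumℤ (map g (filterB K (filterB C xs))))
                                      (sumℤ (map g (filterB K (filterB (λ x → not (C x)) xs)))))
...   | false = sum-split C K g xs

module _ {A : Set} where

  ∈-insert-middle : ∀ xs {y ys} {z : A} → z ∈ xs ++ ys → z ∈ xs ++ y ∷ ys
  ∈-insert-middle xs m with ∈-++⁻ xs m
  ... | inj₁ m′ = ∈-++⁺ˡ m′
  ... | inj₂ m′ = ∈-++⁺ʳ xs (there m′)

  ∈-remove-middle : ∀ xs {y ys} {z : A} → z ∈ xs ++ y ∷ ys → z ≡ y ⊎ z ∈ xs ++ ys
  ∈-remove-middle xs m with ∈-++⁻ xs m
  ... | inj₁ m′ = inj₂ (∈-++⁺ˡ m′)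
  ... | inj₂ (here z≡y) = inj₁ z≡y
  ... | inj₂ (there m′) = inj₂ (∈-++⁺ʳ xs m′)

  Unique-remove-middle : ∀ xs {y : A} {ys} → Unique (xs ++ y ∷ ys) → y ∉ xs ++ ys × Unique (xs ++ ys)
  Unique-remove-middle [] (y∉ys ∷ u) = (λ m → All.lookup y∉ys m refl) , u
  Unique-remove-middle (x ∷ xs) {y} (x∉ ∷ u) with Unique-remove-middle xs u | All.++⁻ xs x∉
  ... | y∉ , u′ | x∉xs , x≢y ∷ x∉ys =
    (λ { (here y≡x) → x≢y (sym y≡x) ; (there m) → y∉ m }) , All.++⁺ x∉xs x∉ys ∷ u′

  length-middle : ∀ xs {y : A} {ys} → length (xs ++ y ∷ ys) ≡ suc (length (xs ++ ys))
  length-middle xs {y} {ys} =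
    trans (length-++ xs) (trans (+-suc (length xs) (length ys)) (cong suc (sym (length-++ xs))))

  sum-middle : ∀ (g : A → ℤ) xs {y ys} → sumℤ (map g (xs ++ y ∷ ys)) ≡ g y ℤ.+ sumℤ (map g (xs ++ ys))
  sum-middle g [] = refl
  sum-middle g (x ∷ xs) {y} {ys} =
    trans (cong (λ s → g x ℤ.+ s) (sum-middle g xs)) (x∙yz≈y∙xz (g x) (g y) (sumℤ (map g (xs ++ ys))))

record SignReversingInvolution {A : Set} (ι : A → A) (g : A → ℤ) (M : List A) : Set where
  field
    unique : Unique M
    closed : ∀ {x} → x ∈ M → ι x ∈ M
    involutive : ∀ {x} → x ∈ M → ι (ι x) ≡ x
    moves : ∀ {x} → x ∈ M → ι x ≢ x
    reverses : ∀ {x} → x ∈ M → g (ι x) ≡ ℤ.- g x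

module _ {A : Set} {ι : A → A} {g : A → ℤ} where
  open SignReversingInvolution

  partner : ∀ {x M} → SignReversingInvolution ι g (x ∷ M) → ι x ∈ M
  partner s with closed s (here refl)
  ... | here ιx≡x = ⊥-elim (moves s (here refl) ιx≡x)
  ... | there ιx∈M = ιx∈M

  removeOrbit : ∀ {x} As Bs → SignReversingInvolution ι g (x ∷ As ++ ι x ∷ Bs) →
                SignReversingInvolution ι g (As ++ Bs)
  removeOrbit {x} As Bs s = record
    { unique = proj₂ (Unique-remove-middle As uniqueTail)
    ; closed = closed′
    ; involutive = λ m → involutive s (lift m)
    ; moves = λ m → moves s (lift m)
    ; reverses = λ m → reverses s (lift m)
    }
    where
    lift : ∀ {z} → z ∈ As ++ Bs → z ∈ x ∷ As ++ ι x ∷ Bs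
    lift m = there (∈-insert-middle As m)

    x∉ : x ∉ As ++ ι x ∷ Bs
    x∉ m with unique s
    ... | x∉tail ∷ _ = All.lookup x∉tail m refl

    uniqueTail : Unique (As ++ ι x ∷ Bs)
    uniqueTail with unique s
    ... | _ ∷ u = u

    closed′ : ∀ {z} → z ∈ As ++ Bs → ι z ∈ As ++ Bs
    closed′ {z} m with closed s (lift m)
    ... | here ιz≡x = ⊥-elim (proj₁ (Unique-remove-middle As uniqueTail)
                        (subst (_∈ As ++ Bs) (trans (sym (involutive s (lift m))) (cong ι ιz≡x)) m))
    ... | there m′ with ∈-remove-middle As m′
    ...   | inj₂ m″ = m″
    ...   | inj₁ ιz≡ιx = ⊥-elim (x∉ (subst (_∈ As ++ ι x ∷ Bs)
                           (trans (sym (involutive s (lift m))) (trans (cong ι ιz≡ιx) (involutive s (here refl))))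
                           (∈-insert-middle As m)))

  -- the terms of Σ_{x ∈ M} g x cancel in pairs {x, ι x}
  sum-cancels : ∀ M → SignReversingInvolution ι g M → sumℤ (map g M) ≡ ℤ.+ 0
  sum-cancels M = byLength (length M) M ≤-refl
    where
    byLength : ∀ k M → length M ≤ k → SignReversingInvolution ι g M → sumℤ (map g M) ≡ ℤ.+ 0
    byLength k [] _ _ = refl
    byLength (suc k) (x ∷ M′) (s≤s len) s with ∈-∃++ (partner s)
    ... | As , Bs , refl = begin
      g x ℤ.+ sumℤ (map g (As ++ ι x ∷ Bs))      ≡⟨ cong (λ t → g x ℤ.+ t) (sum-middle g As) ⟩
      g x ℤ.+ (g (ι x) ℤ.+ rest)                 ≡⟨ cong (λ t → g x ℤ.+ (t ℤ.+ rest)) (reverses s (here refl)) ⟩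
      g x ℤ.+ (ℤ.- g x ℤ.+ rest)                 ≡⟨ ℤP.+-assoc (g x) (ℤ.- g x) rest ⟨
      (g x ℤ.+ ℤ.- g x) ℤ.+ rest                 ≡⟨ cong (ℤ._+ rest) (ℤP.+-inverseʳ (g x)) ⟩
      ℤ.+ 0 ℤ.+ rest                             ≡⟨ ℤP.+-identityˡ rest ⟩
      rest                                       ≡⟨ byLength k (As ++ Bs) shorter (removeOrbit As Bs s) ⟩
      ℤ.+ 0                                      ∎
      where
      open ≡-Reasoning
      rest = sumℤ (map g (As ++ Bs))
      shorter : length (As ++ Bs) ≤ k
      shorter = ≤-trans (n≤1+n (length (As ++ Bs))) (subst (_≤ k) (length-middle As) len)

sign : Window → ℤ
sign w = signPow (ℓD w)

hasStatistics : ℕ → ℕ → Window → Bool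
hasStatistics a b w = (oinv w ≡ᵇ a) ∧ (onsp w ≡ᵇ b)

nonChessboard : ℕ → ℕ → ℕ → List Window
nonChessboard n a b = filterB (hasStatistics a b) (filterB (λ w → not (isChessboard w)) (Dn n))

record Member (n a b : ℕ) (w : Window) : Set where
  field
    enumerated : w ∈ words n n
    inDn : isDn n w ≡ true
    notChessboard : isChessboard w ≡ false
    statistics : hasStatistics a b w ≡ true

module _ {n a b : ℕ} where

  member⁻ : ∀ {w} → w ∈ nonChessboard n a b → Member n a b w
  member⁻ m =
    let (m₁ , st) = ∈-filterB⁻ (hasStatistics a b) _ m
        (m₂ , nc) = ∈-filterB⁻ (λ w → not (isChessboard w)) _ m₁
        (m₃ , d) = ∈-filterB⁻ (λ w → isDn n w) (words n n) m₂
    in record { enumerated = m₃ ; inDn = d ; notChessboard = not-true nc ; statistics = st }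
    where
    not-true : ∀ {p} → not p ≡ true → p ≡ false
    not-true {false} _ = refl

  member⁺ : ∀ {w} → Member n a b w → w ∈ nonChessboard n a b
  member⁺ μ = ∈-filterB⁺ (hasStatistics a b) _
    (∈-filterB⁺ (λ w → not (isChessboard w)) _
      (∈-filterB⁺ (λ w → isDn n w) (words n n) (Member.enumerated μ) (Member.inDn μ))
      (cong not (Member.notChessboard μ)))
    (Member.statistics μ)

  module _ {w} (μ : Member n a b w) where
    private
      σ = isDn⇒SignedPerm n w (Member.inDn μ)
      br = findBreak σ (Member.notChessboard μ)

    involution-member : Member n a b (involution n w)
    involution-member = record
      { enumerated = signedPerm∈words (isDn⇒SignedPerm n _ (involution-isDn σ br))
      ; inDn = involution-isDn σ br
      ; notChessboard = trans (involution-chessboard σ br) (Member.notChessboard μ)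
      ; statistics = trans (cong₂ (λ p q → (p ≡ᵇ a) ∧ (q ≡ᵇ b)) (involution-oinv σ br) (involution-onsp σ br))
                           (Member.statistics μ)
      }

    member-involutive : involution n (involution n w) ≡ w
    member-involutive = involution-involutive σ br

    member-moves : involution n w ≢ w
    member-moves = involution-moves σ br

    member-sign : sign (involution n w) ≡ ℤ.- sign w
    member-sign = involution-sign σ br

  nonChessboard-involution : SignReversingInvolution (involution n) sign (nonChessboard n a b)
  nonChessboard-involution = record
    { unique = filterB-unique _ _ (filterB-unique _ _ (filterB-unique _ (words n n) (words-unique n n)))
    ; closed = λ m → member⁺ (involution-member (member⁻ m))
    ; involutive = λ m → member-involutive (member⁻ m)
    ; moves = λ m → member-moves (member⁻ m)
    ; reverses = λ m → member-sign (member⁻ m)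
    }

-- Each coefficient splits into its chessboard and non-chessboard parts, and
-- the latter vanishes; the argument does not need n ≥ 2.
mainTheorem13 : (n : ℕ) → 2 ≤ n → (a b : ℕ) → coeff (Dn n) a b ≡ coeff (CDn n) a b
mainTheorem13 n _ a b = begin
  coeff (Dn n) a b
    ≡⟨ sum-split isChessboard (hasStatistics a b) sign (Dn n) ⟩
  coeff (CDn n) a b ℤ.+ sumℤ (map sign (nonChessboard n a b))
    ≡⟨ cong (λ s → coeff (CDn n) a b ℤ.+ s) (sum-cancels (nonChessboard n a b) (nonChessboard-involution {n} {a} {b})) ⟩
  coeff (CDn n) a b ℤ.+ ℤ.+ 0
    ≡⟨ ℤP.+-identityʳ (coeff (CDn n) a b) ⟩
  coeff (CDn n) a b ∎
  where open ≡-Reasoning
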